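{- Let $k\ge 0$ and $l\ge 0$ be integers with $2l\le k+1$. Then \[\sum_{\substack{\nu=2l\\ \nu\ \text{even}}}^{k+1}\binom{k}{\nu-1}\frac{\nu!\,2^{k-\nu+1}}{(\nu/2-l)!\,(\nu/2+l+1)!} =\frac{4(k^2+k+4l^2+4l)\,\Gamma(2k+2)}{\Gamma(k+2l+4)\,\Gamma(k-2l+2)},\] where, when $l=0$, the $\nu=0$ term of the sum is taken to be $0$. -}

module Defs where

open import Data.Nat using (ℕ; zero; suc; _+_; _*_; _∸_; _^_; _!; _/_; _%_; _≡ᵇ_; _≤ᵇ_)
open import Data.Nat.Properties using (_!*_!≢0)
open import Data.Nat.Combinatorics using (_C_)
open import Data.Integer using (+_)
open import Data.Bool using (Bool; true; false; if_then_else_; _∧_; not)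
open import Data.List using (List; map; foldr; upTo)
open import Data.Rational using (ℚ; 0ℚ) renaming (_+_ to _+ℚ_; _/_ to _/ℚ_)

-- Γ(n+1) = n! for natural n; we write all Gamma values at positive
-- integers as factorials: Γ(2k+2) = (2k+1)!, Γ(k+2l+4) = (k+2l+3)!,
-- Γ(k-2l+2) = (k+1-2l)!.

divFacts : ℕ → ℕ → ℕ → ℚ
divFacts a b c = _/ℚ_ (+ a) (b ! * c !) {{b !* c !≢0}}

sumℚ : List ℚ → ℚ
sumℚ = foldr _+ℚ_ 0ℚ

summand : ℕ → ℕ → ℕ → ℚ
summand k l ν =
  if (ν % 2 ≡ᵇ 0) ∧ ((2 * l) ≤ᵇ ν) ∧ not (ν ≡ᵇ 0)
  then divFacts ((k C (ν ∸ 1)) * (ν !) * 2 ^ (k + 1 ∸ ν)) (ν / 2 ∸ l) (ν / 2 + l + 1)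
  else 0ℚ

lhs : ℕ → ℕ → ℚ
lhs k l = sumℚ (map (summand k l) (upTo (k + 2)))

rhs : ℕ → ℕ → ℚ
rhs k l = divFacts (4 * (k * k + k + 4 * (l * l) + 4 * l) * ((2 * k + 1) !))
                   (k + 2 * l + 3) (k + 1 ∸ 2 * l)

-- Multiplied by (k+1)(k+2), the summand with ν = 2l + 2u becomes the integer
-- ν · 2^(K-ν-1) C(K, ν+1) C(ν+1, u), where K = k + 2.  Such products count monomials of
-- (x + 2 + x⁻¹)ᴺ: choosing i of the N factors to be x^(±1), t of them x⁻¹, gives x^(i-2t)
-- with weight 2^(N-i) C(N, i) C(i, t).  As (x + 2 + x⁻¹)ᴺ = x⁻ᴺ (1 + x)^(2N), the
-- coefficient of xʲ is C(2N, N + j), verified through a common Pascal-type recurrence in N.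
-- Absorption, (ν+1) C(K, ν+1) = K C(K-1, ν), and Pascal's rule in the lower index express
-- the scaled sum through C(2k+2, k+1+2l), C(2k+2, k+3+2l) and C(2k+4, k+3+2l); clearing
-- factorials leaves a polynomial identity in k and l.

{-# OPTIONS --safe #-}
module Submission where

open import Data.Bool using (Bool; true; false; if_then_else_; T; _∧_; not)
open import Data.Bool.Properties using (T-∧; T-≡)
import Data.Integer as ℤ
open import Data.Integer.Properties using (pos-*; pos-+)
import Data.Integer.Tactic.RingSolver as ℤ-Solver
open import Data.List using (_∷_; map; applyUpTo)
open import Data.Nat
open import Data.Nat.Properties
open import Algebra.Properties.CommutativeSemigroup +-commutativeSemigroup using (interchange)
open import Data.Nat.Combinatorics using (_C_; nCk≡nC[n∸k]; nCk+nC[k+1]≡[n+1]C[k+1]; k![n∸k]!∣n!)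
open import Data.Nat.Combinatorics.Specification using (nCk≡n!/k![n-k]!; k>n⇒nCk≡0)
open import Data.Nat.DivMod using (m/n*n≡m; m*n/n≡m; m≡m%n+[m/n]*n; [m+kn]%n≡m%n)
open import Data.Nat.Tactic.RingSolver using (solve-∀)
open import Data.Empty using (⊥-elim)
open import Data.Product using (_×_; _,_; proj₁; proj₂)
open import Data.Rational using (ℚ; 0ℚ; toℚᵘ) renaming (_/_ to _/ℚ_)
open import Data.Rational.Properties using (toℚᵘ-fromℚᵘ; toℚᵘ-homo-+; toℚᵘ-injective)
open import Data.Rational.Unnormalised as ℚᵘ using (mkℚᵘ; *≡*; _≃_) renaming (_/_ to _/ᵘ_)
open import Data.Rational.Unnormalised.Properties using (≃-reflexive; ≃-trans; ≃-sym) renaming (+-cong to +ᵘ-cong)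
open import Function.Bundles using (Equivalence)
open import Relation.Binary.PropositionalEquality
open import Relation.Nullary using (yes; no)

open import Defs

open ≡-Reasoning

∑ : ℕ → (ℕ → ℕ) → ℕ
∑ zero    f = 0
∑ (suc n) f = f 0 + ∑ n (λ i → f (suc i))

∑-cong : ∀ n {f g : ℕ → ℕ} → (∀ i → i < n → f i ≡ g i) → ∑ n f ≡ ∑ n g
∑-cong zero    f≡g = refl
∑-cong (suc n) f≡g = cong₂ _+_ (f≡g 0 z<s) (∑-cong n (λ i i<n → f≡g (suc i) (s<s i<n)))

∑-+ : ∀ n (f g : ℕ → ℕ) → ∑ n (λ i → f i + g i) ≡ ∑ n f + ∑ n g
∑-+ zero    f g = refl
∑-+ (suc n) f g = trans (cong (f 0 + g 0 +_) (∑-+ n _ _)) (interchange (f 0) (g 0) _ _)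

∑-*ˡ : ∀ n c (f : ℕ → ℕ) → ∑ n (λ i → c * f i) ≡ c * ∑ n f
∑-*ˡ zero    c f = sym (*-zeroʳ c)
∑-*ˡ (suc n) c f = trans (cong (c * f 0 +_) (∑-*ˡ n c _)) (sym (*-distribˡ-+ c (f 0) _))

∑-zeros : ∀ n (f : ℕ → ℕ) → (∀ i → i < n → f i ≡ 0) → ∑ n f ≡ 0
∑-zeros zero    f f≡0 = refl
∑-zeros (suc n) f f≡0 = cong₂ _+_ (f≡0 0 z<s) (∑-zeros n _ (λ i i<n → f≡0 (suc i) (s<s i<n)))

∑-++ : ∀ m n (f : ℕ → ℕ) → ∑ (m + n) f ≡ ∑ m f + ∑ n (λ i → f (m + i))
∑-++ zero    n f = refl
∑-++ (suc m) n f = trans (cong (f 0 +_) (∑-++ m n _)) (sym (+-assoc (f 0) _ _))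

∑-pairs : ∀ n (f : ℕ → ℕ) → ∑ (2 * n) f ≡ ∑ n (λ i → f (2 * i) + f (suc (2 * i)))
∑-pairs zero    f = refl
∑-pairs (suc n) f = begin
  ∑ (2 * suc n) f
    ≡⟨ cong (λ m → ∑ m f) (*-suc 2 n) ⟩
  f 0 + (f 1 + ∑ (2 * n) (λ i → f (2 + i)))
    ≡⟨ cong (λ s → f 0 + (f 1 + s)) (∑-pairs n _) ⟩
  f 0 + (f 1 + ∑ n (λ i → f (2 + 2 * i) + f (3 + 2 * i)))
    ≡⟨ sym (+-assoc (f 0) (f 1) _) ⟩
  f 0 + f 1 + ∑ n (λ i → f (2 + 2 * i) + f (3 + 2 * i))
    ≡⟨ cong (f 0 + f 1 +_) (∑-cong n (λ i _ → cong₂ _+_ (cong f (sym (*-suc 2 i))) (cong (λ m → f (suc m)) (sym (*-suc 2 i))))) ⟩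
  f 0 + f 1 + ∑ n (λ i → f (2 * suc i) + f (suc (2 * suc i))) ∎

∑-vanishing-tail : ∀ {m n} (f : ℕ → ℕ) → (∀ i → m ≤ i → f i ≡ 0) → m ≤ n → ∑ n f ≡ ∑ m f
∑-vanishing-tail {m} {n} f f≡0 m≤n = begin
  ∑ n f                               ≡⟨ cong (λ k → ∑ k f) (m+[n∸m]≡n m≤n) ⟨
  ∑ (m + (n ∸ m)) f                   ≡⟨ ∑-++ m (n ∸ m) f ⟩
  ∑ m f + ∑ (n ∸ m) (λ i → f (m + i)) ≡⟨ cong (∑ m f +_) (∑-zeros (n ∸ m) _ (λ i _ → f≡0 (m + i) (m≤m+n m i))) ⟩
  ∑ m f + 0                           ≡⟨ +-identityʳ _ ⟩
  ∑ m f                               ∎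

∑-even-from : ∀ a n (f : ℕ → ℕ) → (∀ i → i < a → f i ≡ 0) → (∀ u → f (a + suc (2 * u)) ≡ 0) →
              ∑ (a + 2 * n) f ≡ ∑ n (λ u → f (a + 2 * u))
∑-even-from a n f below odd = begin
  ∑ (a + 2 * n) f                                 ≡⟨ ∑-++ a (2 * n) f ⟩
  ∑ a f + ∑ (2 * n) (λ i → f (a + i))             ≡⟨ cong (_+ ∑ (2 * n) (λ i → f (a + i))) (∑-zeros a f below) ⟩
  ∑ (2 * n) (λ i → f (a + i))                     ≡⟨ ∑-pairs n (λ i → f (a + i)) ⟩
  ∑ n (λ u → f (a + 2 * u) + f (a + suc (2 * u))) ≡⟨ ∑-cong n (λ u _ → trans (cong (f (a + 2 * u) +_) (odd u)) (+-identityʳ _)) ⟩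
  ∑ n (λ u → f (a + 2 * u))                       ∎

pascal : ∀ n k → suc n C suc k ≡ n C k + n C suc k
pascal n k = sym (nCk+nC[k+1]≡[n+1]C[k+1] n k)

pascal² : ∀ n k → suc (suc n) C suc (suc k) ≡ n C k + 2 * (n C suc k) + n C suc (suc k)
pascal² n k = begin
  suc (suc n) C suc (suc k)                           ≡⟨ pascal (suc n) (suc k) ⟩
  suc n C suc k + suc n C suc (suc k)                 ≡⟨ cong₂ _+_ (pascal n k) (pascal n (suc k)) ⟩
  (n C k + n C suc k) + (n C suc k + n C suc (suc k)) ≡⟨ regroup (n C k) (n C suc k) (n C suc (suc k)) ⟩
  n C k + 2 * (n C suc k) + n C suc (suc k)           ∎
  where
  regroup : ∀ a b c → (a + b) + (b + c) ≡ a + 2 * b + c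
  regroup = solve-∀

nCk*[k!*r!]≡n! : ∀ {n} k r → k + r ≡ n → (n C k) * (k ! * r !) ≡ n !
nCk*[k!*r!]≡n! k r refl =
  subst (λ m → ((k + r) C k) * (k ! * m !) ≡ (k + r) !) (m+n∸m≡n k r)
    (trans (cong (_* (k ! * (k + r ∸ k) !)) (nCk≡n!/k![n-k]! k≤k+r))
           (m/n*n≡m {{k !* (k + r ∸ k) !≢0}} (k![n∸k]!∣n! k≤k+r)))
  where
  k≤k+r : k ≤ k + r
  k≤k+r = m≤m+n k r

[1+k]*[1+n]C[1+k]≡[1+n]*nCk : ∀ n k → suc k * (suc n C suc k) ≡ suc n * (n C k)
[1+k]*[1+n]C[1+k]≡[1+n]*nCk n k with k ≤? n
... | no k≰n = begin
  suc k * (suc n C suc k) ≡⟨ cong (suc k *_) (k>n⇒nCk≡0 (s<s k>n)) ⟩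
  suc k * 0               ≡⟨ *-zeroʳ (suc k) ⟩
  0                       ≡⟨ *-zeroʳ (suc n) ⟨
  suc n * 0               ≡⟨ cong (suc n *_) (k>n⇒nCk≡0 k>n) ⟨
  suc n * (n C k)         ∎
  where
  k>n : k > n
  k>n = ≰⇒> k≰n
... | yes k≤n = *-cancelʳ-≡ _ _ (k ! * r !) {{k !* r !≢0}} (begin
  suc k * (suc n C suc k) * (k ! * r !) ≡⟨ reassoc (suc k) (suc n C suc k) (k !) (r !) ⟩
  (suc n C suc k) * (suc k ! * r !)     ≡⟨ nCk*[k!*r!]≡n! (suc k) r (cong suc k+r≡n) ⟩
  suc n * n !                           ≡⟨ cong (suc n *_) (nCk*[k!*r!]≡n! k r k+r≡n) ⟨
  suc n * ((n C k) * (k ! * r !))       ≡⟨ *-assoc (suc n) (n C k) (k ! * r !) ⟨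
  suc n * (n C k) * (k ! * r !)         ∎)
  where
  r = n ∸ k
  k+r≡n : k + r ≡ n
  k+r≡n = m+[n∸m]≡n k≤n
  reassoc : ∀ a c x y → a * c * (x * y) ≡ c * (a * x * y)
  reassoc = solve-∀

absorption² : ∀ n k → suc k * suc (suc k) * (suc (suc n) C suc (suc k)) ≡ suc n * suc (suc n) * (n C k)
absorption² n k = begin
  suc k * suc (suc k) * (suc (suc n) C suc (suc k))   ≡⟨ *-assoc (suc k) (suc (suc k)) (suc (suc n) C suc (suc k)) ⟩
  suc k * (suc (suc k) * (suc (suc n) C suc (suc k))) ≡⟨ cong (suc k *_) ([1+k]*[1+n]C[1+k]≡[1+n]*nCk (suc n) (suc k)) ⟩
  suc k * (suc (suc n) * (suc n C suc k))             ≡⟨ x[yz]≡y[xz] (suc k) (suc (suc n)) (suc n C suc k) ⟩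
  suc (suc n) * (suc k * (suc n C suc k))             ≡⟨ cong (suc (suc n) *_) ([1+k]*[1+n]C[1+k]≡[1+n]*nCk n k) ⟩
  suc (suc n) * (suc n * (n C k))                     ≡⟨ x[yz]≡[yx]z (suc (suc n)) (suc n) (n C k) ⟩
  suc n * suc (suc n) * (n C k)                       ∎
  where
  x[yz]≡y[xz] : ∀ x y z → x * (y * z) ≡ y * (x * z)
  x[yz]≡y[xz] = solve-∀
  x[yz]≡[yx]z : ∀ x y z → x * (y * z) ≡ y * x * z
  x[yz]≡[yx]z = solve-∀

[1+2t]Ct≡[1+2t]C[1+t] : ∀ t → suc (2 * t) C t ≡ suc (2 * t) C suc t
[1+2t]Ct≡[1+2t]C[1+t] t = begin
  suc (2 * t) C t                 ≡⟨ nCk≡nC[n∸k] t≤1+2t ⟩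
  suc (2 * t) C (suc (2 * t) ∸ t) ≡⟨ cong (suc (2 * t) C_) (+-∸-assoc 1 t≤2t) ⟩
  suc (2 * t) C suc (2 * t ∸ t)   ≡⟨ cong (λ m → suc (2 * t) C suc m) 2t∸t≡t ⟩
  suc (2 * t) C suc t             ∎
  where
  t≤2t : t ≤ 2 * t
  t≤2t = m≤n*m t 2
  t≤1+2t : t ≤ suc (2 * t)
  t≤1+2t = m≤n⇒m≤1+n t≤2t
  2t∸t≡t : 2 * t ∸ t ≡ t
  2t∸t≡t = trans (cong (_∸ t) (cong (t +_) (+-identityʳ t))) (m+n∸m≡n t t)

nCk*[[2+k]!*r!]≡n!*[[2+k]*[1+k]] : ∀ {n} k r → k + r ≡ n → (n C k) * ((2 + k) ! * r !) ≡ n ! * ((2 + k) * (1 + k))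
nCk*[[2+k]!*r!]≡n!*[[2+k]*[1+k]] {n} k r k+r≡n = begin
  (n C k) * ((2 + k) ! * r !)                 ≡⟨ reassoc (n C k) (2 + k) (1 + k) (k !) (r !) ⟩
  (n C k) * (k ! * r !) * ((2 + k) * (1 + k)) ≡⟨ cong (_* ((2 + k) * (1 + k))) (nCk*[k!*r!]≡n! k r k+r≡n) ⟩
  n ! * ((2 + k) * (1 + k))                   ∎
  where
  reassoc : ∀ c a b f g → c * ((a * (b * f)) * g) ≡ c * (f * g) * (a * b)
  reassoc = solve-∀

k+r≡n⇒n<2+k : ∀ {n k r} → r < 2 → k + r ≡ n → n < 2 + k
k+r≡n⇒n<2+k {k = k} {r} r<2 refl = subst (k + r <_) (+-comm k 2) (+-monoʳ-< k r<2)

nC[2+k]*[[2+k]!*r!]≡n!*[r*[r∸1]] : ∀ {n} k r → k + r ≡ n → (n C (2 + k)) * ((2 + k) ! * r !) ≡ n ! * (r * (r ∸ 1))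
nC[2+k]*[[2+k]!*r!]≡n!*[r*[r∸1]] {n} k zero          k+0≡n =
  trans (cong (_* ((2 + k) ! * 1)) (k>n⇒nCk≡0 (k+r≡n⇒n<2+k z<s k+0≡n))) (sym (*-zeroʳ (n !)))
nC[2+k]*[[2+k]!*r!]≡n!*[r*[r∸1]] {n} k (suc zero)    k+1≡n =
  trans (cong (_* ((2 + k) ! * 1)) (k>n⇒nCk≡0 (k+r≡n⇒n<2+k (s<s z<s) k+1≡n))) (sym (*-zeroʳ (n !)))
nC[2+k]*[[2+k]!*r!]≡n!*[r*[r∸1]] {n} k (suc (suc r)) k+2+r≡n = begin
  (n C (2 + k)) * ((2 + k) ! * (2 + r) !)                 ≡⟨ reassoc (n C (2 + k)) ((2 + k) !) (2 + r) (1 + r) (r !) ⟩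
  (n C (2 + k)) * ((2 + k) ! * r !) * ((2 + r) * (1 + r)) ≡⟨ cong (_* ((2 + r) * (1 + r))) (nCk*[k!*r!]≡n! (2 + k) r 2+k+r≡n) ⟩
  n ! * ((2 + r) * (1 + r))                               ∎
  where
  2+k+r≡n : 2 + k + r ≡ n
  2+k+r≡n = trans (cong suc (sym (+-suc k r))) (trans (sym (+-suc k (suc r))) k+2+r≡n)
  reassoc : ∀ c f a b g → c * (f * (a * (b * g))) ≡ c * (f * g) * (a * b)
  reassoc = solve-∀

-- The coefficients of (x + 2 + x⁻¹)ᴺ

term : ℕ → ℕ → ℕ → ℕ
term N i t = 2 ^ (N ∸ i) * ((N C i) * (i C t))

terms : ℕ → ℕ → ℕ → ℕ
terms N j t = term N (j + 2 * t) t

coeff : ℕ → ℕ → ℕ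
coeff N j = ∑ (suc N) (terms N j)

shift : (ℕ → ℕ) → ℕ → ℕ
shift f zero    = 0
shift f (suc t) = f t

term-vanishes : ∀ {N i} t → N < i → term N i t ≡ 0
term-vanishes {N} {i} t N<i = begin
  2 ^ (N ∸ i) * ((N C i) * (i C t)) ≡⟨ cong (λ c → 2 ^ (N ∸ i) * (c * (i C t))) (k>n⇒nCk≡0 N<i) ⟩
  2 ^ (N ∸ i) * 0                   ≡⟨ *-zeroʳ (2 ^ (N ∸ i)) ⟩
  0                                 ∎

terms-vanish : ∀ {N j m} → N < j + 2 * m → ∀ t → m ≤ t → terms N j t ≡ 0
terms-vanish {j = j} N<j+2m t m≤t = term-vanishes t (<-≤-trans N<j+2m (+-monoʳ-≤ j (*-monoʳ-≤ 2 m≤t)))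

∑-terms≡coeff : ∀ N {B} j → suc N ≤ B → ∑ B (terms N j) ≡ coeff N j
∑-terms≡coeff N j = ∑-vanishing-tail (terms N j) (terms-vanish {N} {j} N<j+2[1+N])
  where
  N<j+2[1+N] : N < j + 2 * suc N
  N<j+2[1+N] = <-≤-trans (n<1+n N) (≤-trans (m≤n*m (suc N) 2) (m≤n+m (2 * suc N) j))

-- When 1 + i > N both sides vanish, so the truncated subtraction N ∸ i is harmless.
2^[N∸i]*NC[1+i]≡2*2^[N∸1+i]*NC[1+i] : ∀ N i → 2 ^ (N ∸ i) * (N C suc i) ≡ 2 * (2 ^ (N ∸ suc i) * (N C suc i))
2^[N∸i]*NC[1+i]≡2*2^[N∸1+i]*NC[1+i] N i with suc i ≤? N
... | yes i<N = begin
  2 ^ (N ∸ i) * (N C suc i)           ≡⟨ cong (λ e → 2 ^ e * (N C suc i)) (+-∸-assoc 1 i<N) ⟩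
  2 * 2 ^ (N ∸ suc i) * (N C suc i)   ≡⟨ *-assoc 2 (2 ^ (N ∸ suc i)) (N C suc i) ⟩
  2 * (2 ^ (N ∸ suc i) * (N C suc i)) ∎
... | no  i≮N = begin
  2 ^ (N ∸ i) * (N C suc i)           ≡⟨ cong (2 ^ (N ∸ i) *_) NC[1+i]≡0 ⟩
  2 ^ (N ∸ i) * 0                     ≡⟨ *-zeroʳ (2 ^ (N ∸ i)) ⟩
  0                                   ≡⟨ cong (2 *_) (*-zeroʳ (2 ^ (N ∸ suc i))) ⟨
  2 * (2 ^ (N ∸ suc i) * 0)           ≡⟨ cong (λ c → 2 * (2 ^ (N ∸ suc i) * c)) NC[1+i]≡0 ⟨
  2 * (2 ^ (N ∸ suc i) * (N C suc i)) ∎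
  where
  NC[1+i]≡0 : N C suc i ≡ 0
  NC[1+i]≡0 = k>n⇒nCk≡0 (≰⇒> i≮N)

term-suc-upper : ∀ N i t → term (suc N) (suc i) t ≡ 2 * term N (suc i) t + 2 ^ (N ∸ i) * ((N C i) * (suc i C t))
term-suc-upper N i t = begin
  p * ((suc N C suc i) * c)                      ≡⟨ cong (λ b → p * (b * c)) (pascal N i) ⟩
  p * ((N C i + N C suc i) * c)                  ≡⟨ distrib p (N C i) (N C suc i) c ⟩
  p * (N C suc i) * c + p * ((N C i) * c)        ≡⟨ cong (λ x → x * c + p * ((N C i) * c)) (2^[N∸i]*NC[1+i]≡2*2^[N∸1+i]*NC[1+i] N i) ⟩
  2 * (p′ * (N C suc i)) * c + p * ((N C i) * c) ≡⟨ cong (_+ p * ((N C i) * c)) (reassoc 2 p′ (N C suc i) c) ⟩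
  2 * term N (suc i) t + p * ((N C i) * c)       ∎
  where
  p = 2 ^ (N ∸ i)
  p′ = 2 ^ (N ∸ suc i)
  c = suc i C t
  distrib : ∀ p a b c → p * ((a + b) * c) ≡ p * b * c + p * (a * c)
  distrib = solve-∀
  reassoc : ∀ a p b c → a * (p * b) * c ≡ a * (p * (b * c))
  reassoc = solve-∀

term-suc-lower : ∀ N i t → 2 ^ (N ∸ i) * ((N C i) * (suc i C t)) ≡ term N i t + shift (term N i) t
term-suc-lower N i zero    = sym (+-identityʳ (term N i 0))
term-suc-lower N i (suc t) = begin
  p * ((N C i) * (suc i C suc t))     ≡⟨ cong (λ c → p * ((N C i) * c)) (pascal i t) ⟩
  p * ((N C i) * (i C t + i C suc t)) ≡⟨ distrib p (N C i) (i C t) (i C suc t) ⟩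
  term N i (suc t) + term N i t       ∎
  where
  p = 2 ^ (N ∸ i)
  distrib : ∀ p a b c → p * (a * (b + c)) ≡ p * (a * c) + p * (a * b)
  distrib = solve-∀

term-suc : ∀ N i t → term (suc N) (suc i) t ≡ 2 * term N (suc i) t + (term N i t + shift (term N i) t)
term-suc N i t = trans (term-suc-upper N i t) (cong (2 * term N (suc i) t +_) (term-suc-lower N i t))

shift-terms : ∀ N j t → shift (term N (j + 2 * t)) t ≡ shift (terms N (2 + j)) t
shift-terms N j zero    = refl
shift-terms N j (suc t) = cong (λ i → term N i t) (index j t)
  where
  index : ∀ j t → j + 2 * suc t ≡ 2 + j + 2 * t
  index = solve-∀

terms-suc-suc : ∀ N j t → terms (suc N) (suc j) t ≡ 2 * terms N (suc j) t + (terms N j t + shift (terms N (2 + j)) t)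
terms-suc-suc N j t = trans (term-suc N (j + 2 * t) t) (cong (λ x → 2 * terms N (suc j) t + (terms N j t + x)) (shift-terms N j t))

terms-suc-zero : ∀ N t → terms (suc N) 0 t ≡ 2 * terms N 0 t + 2 * shift (terms N 1) t
terms-suc-zero N zero    = base (2 ^ N)
  where
  base : ∀ x → 2 * x * 1 ≡ 2 * (x * 1) + 2 * 0
  base = solve-∀
terms-suc-zero N (suc t) = begin
  term (suc N) (2 * suc t) (suc t)
    ≡⟨ cong (λ i → term (suc N) i (suc t)) (*-suc 2 t) ⟩
  term (suc N) (suc i) (suc t)
    ≡⟨ term-suc N i (suc t) ⟩
  2 * term N (suc i) (suc t) + (term N i (suc t) + term N i t)
    ≡⟨ cong (λ c → 2 * term N (suc i) (suc t) + (c + term N i t)) middle ⟩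
  2 * term N (suc i) (suc t) + (term N i t + term N i t)
    ≡⟨ cong₂ (λ j x → 2 * term N j (suc t) + x) (sym (*-suc 2 t)) (cong (term N i t +_) (sym (+-identityʳ (term N i t)))) ⟩
  2 * terms N 0 (suc t) + 2 * terms N 1 t ∎
  where
  i = suc (2 * t)
  middle : term N i (suc t) ≡ term N i t
  middle = cong (λ c → 2 ^ (N ∸ i) * ((N C i) * c)) (sym ([1+2t]Ct≡[1+2t]C[1+t] t))

coeff-suc-suc : ∀ N j → coeff (suc N) (suc j) ≡ 2 * coeff N (suc j) + (coeff N j + coeff N (2 + j))
coeff-suc-suc N j = begin
  ∑ B (terms (suc N) (suc j))
    ≡⟨ ∑-cong B (λ t _ → terms-suc-suc N j t) ⟩
  ∑ B (λ t → 2 * a t + (b t + c t))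
    ≡⟨ ∑-+ B (λ t → 2 * a t) (λ t → b t + c t) ⟩
  ∑ B (λ t → 2 * a t) + ∑ B (λ t → b t + c t)
    ≡⟨ cong₂ _+_ (∑-*ˡ B 2 a) (∑-+ B b c) ⟩
  2 * ∑ B a + (∑ B b + ∑ B c)
    ≡⟨ cong₂ (λ x y → 2 * x + (y + ∑ B c)) (∑-terms≡coeff N (suc j) (n≤1+n _)) (∑-terms≡coeff N j (n≤1+n _)) ⟩
  2 * coeff N (suc j) + (coeff N j + coeff N (2 + j)) ∎
  where
  B = suc (suc N)
  a = terms N (suc j)
  b = terms N j
  c = shift (terms N (2 + j))

coeff-suc-zero : ∀ N → coeff (suc N) 0 ≡ 2 * coeff N 0 + 2 * coeff N 1
coeff-suc-zero N = begin
  ∑ B (terms (suc N) 0)                             ≡⟨ ∑-cong B (λ t _ → terms-suc-zero N t) ⟩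
  ∑ B (λ t → 2 * terms N 0 t + 2 * c t)             ≡⟨ ∑-+ B (λ t → 2 * terms N 0 t) (λ t → 2 * c t) ⟩
  ∑ B (λ t → 2 * terms N 0 t) + ∑ B (λ t → 2 * c t) ≡⟨ cong₂ _+_ (∑-*ˡ B 2 (terms N 0)) (∑-*ˡ B 2 c) ⟩
  2 * ∑ B (terms N 0) + 2 * ∑ B c                   ≡⟨ cong (λ x → 2 * x + 2 * ∑ B c) (∑-terms≡coeff N 0 (n≤1+n _)) ⟩
  2 * coeff N 0 + 2 * coeff N 1                     ∎
  where
  B = suc (suc N)
  c = shift (terms N 1)

central-suc-suc : ∀ N j → 2 * suc N C (suc N + suc j) ≡ 2 * (2 * N C (N + suc j)) + (2 * N C (N + j) + 2 * N C (N + (2 + j)))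
central-suc-suc N j = begin
  2 * suc N C (suc N + suc j)
    ≡⟨ cong₂ _C_ (*-suc 2 N) (cong suc (+-suc N j)) ⟩
  suc (suc (2 * N)) C suc (suc (N + j))
    ≡⟨ pascal² (2 * N) (N + j) ⟩
  a + 2 * b + c
    ≡⟨ regroup a b c ⟩
  2 * b + (a + c)
    ≡⟨ cong₂ (λ x y → 2 * (2 * N C x) + (a + 2 * N C y)) (sym (+-suc N j)) (sym N+[2+j]) ⟩
  2 * (2 * N C (N + suc j)) + (a + 2 * N C (N + (2 + j))) ∎
  where
  a = 2 * N C (N + j)
  b = 2 * N C suc (N + j)
  c = 2 * N C suc (suc (N + j))
  N+[2+j] : N + (2 + j) ≡ suc (suc (N + j))
  N+[2+j] = trans (+-suc N (suc j)) (cong suc (+-suc N j))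
  regroup : ∀ a b c → a + 2 * b + c ≡ 2 * b + (a + c)
  regroup = solve-∀

central-suc-zero : ∀ N → 2 * suc N C (suc N + 0) ≡ 2 * (2 * N C (N + 0)) + 2 * (2 * N C (N + 1))
central-suc-zero N = begin
  2 * suc N C (suc N + 0)                       ≡⟨ cong₂ _C_ (*-suc 2 N) (+-identityʳ (suc N)) ⟩
  suc (suc (2 * N)) C suc N                     ≡⟨ pascal (suc (2 * N)) N ⟩
  suc (2 * N) C N + suc (2 * N) C suc N         ≡⟨ cong (_+ suc (2 * N) C suc N) ([1+2t]Ct≡[1+2t]C[1+t] N) ⟩
  suc (2 * N) C suc N + suc (2 * N) C suc N     ≡⟨ cong (suc (2 * N) C suc N +_) (+-identityʳ (suc (2 * N) C suc N)) ⟨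
  2 * (suc (2 * N) C suc N)                     ≡⟨ cong (2 *_) (pascal (2 * N) N) ⟩
  2 * (2 * N C N + 2 * N C suc N)               ≡⟨ *-distribˡ-+ 2 (2 * N C N) (2 * N C suc N) ⟩
  2 * (2 * N C N) + 2 * (2 * N C suc N)         ≡⟨ cong₂ (λ x y → 2 * (2 * N C x) + 2 * (2 * N C y)) (sym (+-identityʳ N)) (+-comm 1 N) ⟩
  2 * (2 * N C (N + 0)) + 2 * (2 * N C (N + 1)) ∎

coeff≡central : ∀ N j → coeff N j ≡ 2 * N C (N + j)
coeff≡central zero    zero    = refl
coeff≡central zero    (suc j) = refl
coeff≡central (suc N) zero    = begin
  coeff (suc N) 0                               ≡⟨ coeff-suc-zero N ⟩
  2 * coeff N 0 + 2 * coeff N 1                 ≡⟨ cong₂ (λ x y → 2 * x + 2 * y) (coeff≡central N 0) (coeff≡central N 1) ⟩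
  2 * (2 * N C (N + 0)) + 2 * (2 * N C (N + 1)) ≡⟨ central-suc-zero N ⟨
  2 * suc N C (suc N + 0)                       ∎
coeff≡central (suc N) (suc j) = begin
  coeff (suc N) (suc j)
    ≡⟨ coeff-suc-suc N j ⟩
  2 * coeff N (suc j) + (coeff N j + coeff N (2 + j))
    ≡⟨ cong₂ (λ x y → 2 * x + y) (coeff≡central N (suc j)) (cong₂ _+_ (coeff≡central N j) (coeff≡central N (2 + j))) ⟩
  2 * (2 * N C (N + suc j)) + (2 * N C (N + j) + 2 * N C (N + (2 + j)))
    ≡⟨ central-suc-suc N j ⟨
  2 * suc N C (suc N + suc j) ∎

weightedSum : ℕ → ℕ → ℕ
weightedSum n j = ∑ (suc (suc n)) (λ u → (j + 2 * u) * term (suc n) (suc (j + 2 * u)) u)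

weighted-term : ∀ n j u → (j + 2 * u) * term (suc n) (suc (j + 2 * u)) u + terms (suc n) (suc j) u
                          ≡ suc n * (terms n j u + shift (terms n (2 + j)) u)
weighted-term n j u = begin
  ν * Φ + Φ                                         ≡⟨ +-comm (ν * Φ) Φ ⟩
  suc ν * Φ                                         ≡⟨ reassoc (suc ν) p (suc n C suc ν) c ⟩
  p * ((suc ν * (suc n C suc ν)) * c)               ≡⟨ cong (λ x → p * (x * c)) ([1+k]*[1+n]C[1+k]≡[1+n]*nCk n ν) ⟩
  p * ((suc n * (n C ν)) * c)                       ≡⟨ reassoc′ p (suc n) (n C ν) c ⟩
  suc n * (p * ((n C ν) * c))                       ≡⟨ cong (suc n *_) (term-suc-lower n ν u) ⟩
  suc n * (term n ν u + shift (term n ν) u)         ≡⟨ cong (λ x → suc n * (term n ν u + x)) (shift-terms n j u) ⟩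
  suc n * (terms n j u + shift (terms n (2 + j)) u) ∎
  where
  ν = j + 2 * u
  p = 2 ^ (n ∸ ν)
  c = suc ν C u
  Φ = term (suc n) (suc ν) u
  reassoc : ∀ a p b c → a * (p * (b * c)) ≡ p * ((a * b) * c)
  reassoc = solve-∀
  reassoc′ : ∀ p a b c → p * ((a * b) * c) ≡ a * (p * (b * c))
  reassoc′ = solve-∀

weightedSum+coeff : ∀ n j → weightedSum n j + coeff (suc n) (suc j) ≡ suc n * (coeff n j + coeff n (2 + j))
weightedSum+coeff n j = begin
  ∑ B w + ∑ B (terms (suc n) (suc j))       ≡⟨ ∑-+ B w (terms (suc n) (suc j)) ⟨
  ∑ B (λ u → w u + terms (suc n) (suc j) u) ≡⟨ ∑-cong B (λ u _ → weighted-term n j u) ⟩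
  ∑ B (λ u → suc n * (a u + c u))           ≡⟨ ∑-*ˡ B (suc n) (λ u → a u + c u) ⟩
  suc n * ∑ B (λ u → a u + c u)             ≡⟨ cong (suc n *_) (∑-+ B a c) ⟩
  suc n * (∑ B a + ∑ B c)                   ≡⟨ cong (λ x → suc n * (x + ∑ B c)) (∑-terms≡coeff n j (n≤1+n _)) ⟩
  suc n * (coeff n j + coeff n (2 + j))     ∎
  where
  B = suc (suc n)
  w = λ u → (j + 2 * u) * term (suc n) (suc (j + 2 * u)) u
  a = terms n j
  c = shift (terms n (2 + j))

weightedSum+central : ∀ n j → weightedSum n j + 2 * suc n C (suc n + suc j) ≡ suc n * (2 * n C (n + j) + 2 * n C (n + (2 + j)))
weightedSum+central n j = begin
  weightedSum n j + 2 * suc n C (suc n + suc j)     ≡⟨ cong (weightedSum n j +_) (coeff≡central (suc n) (suc j)) ⟨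
  weightedSum n j + coeff (suc n) (suc j)           ≡⟨ weightedSum+coeff n j ⟩
  suc n * (coeff n j + coeff n (2 + j))             ≡⟨ cong (suc n *_) (cong₂ _+_ (coeff≡central n j) (coeff≡central n (2 + j))) ⟩
  suc n * (2 * n C (n + j) + 2 * n C (n + (2 + j))) ∎

weightedSum-factorials : ∀ k l a → suc k ≡ 2 * l + a →
  weightedSum (suc k) (2 * l) * ((2 + (suc k + 2 * l)) ! * a !) + (2 * suc (suc k)) !
    ≡ suc (suc k) * ((2 * suc k) ! * ((2 + (suc k + 2 * l)) * (1 + (suc k + 2 * l)) + a * (a ∸ 1)))
weightedSum-factorials k l a 1+k≡2l+a = begin
  W * F + (2 * K) !                               ≡⟨ cong (W * F +_) (nCk*[k!*r!]≡n! (2 + r) a 2+r+a≡2K) ⟨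
  W * F + (2 * K C (2 + r)) * F                   ≡⟨ cong (λ i → W * F + (2 * K C i) * F) K+[1+2l]≡2+r ⟨
  W * F + (2 * K C (K + suc (2 * l))) * F         ≡⟨ *-distribʳ-+ F W (2 * K C (K + suc (2 * l))) ⟨
  (W + 2 * K C (K + suc (2 * l))) * F             ≡⟨ cong (_* F) (weightedSum+central n (2 * l)) ⟩
  K * (2 * n C r + 2 * n C (n + (2 + 2 * l))) * F ≡⟨ cong (λ i → K * (2 * n C r + 2 * n C i) * F) n+[2+2l]≡2+r ⟩
  K * (2 * n C r + 2 * n C (2 + r)) * F           ≡⟨ distrib K (2 * n C r) (2 * n C (2 + r)) F ⟩
  K * ((2 * n C r) * F + (2 * n C (2 + r)) * F)   ≡⟨ cong₂ (λ x y → K * (x + y))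
                                                               (nCk*[[2+k]!*r!]≡n!*[[2+k]*[1+k]] r a r+a≡2n)
                                                               (nC[2+k]*[[2+k]!*r!]≡n!*[r*[r∸1]] r a r+a≡2n) ⟩
  K * ((2 * n) ! * ((2 + r) * (1 + r)) + (2 * n) ! * (a * (a ∸ 1))) ≡⟨ cong (K *_) (*-distribˡ-+ ((2 * n) !) _ _) ⟨
  K * ((2 * n) ! * ((2 + r) * (1 + r) + a * (a ∸ 1)))               ∎
  where
  n = suc k
  K = suc n
  r = n + 2 * l
  W = weightedSum n (2 * l)
  F = (2 + r) ! * a !
  r+a≡2n : r + a ≡ 2 * n
  r+a≡2n = trans (+-assoc n (2 * l) a) (cong (n +_) (trans (sym 1+k≡2l+a) (sym (+-identityʳ n))))
  2+r+a≡2K : 2 + r + a ≡ 2 * K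
  2+r+a≡2K = trans (cong (2 +_) r+a≡2n) (sym (*-suc 2 n))
  K+[1+2l]≡2+r : K + suc (2 * l) ≡ 2 + r
  K+[1+2l]≡2+r = cong suc (+-suc n (2 * l))
  n+[2+2l]≡2+r : n + (2 + 2 * l) ≡ 2 + r
  n+[2+2l]≡2+r = trans (+-suc n (suc (2 * l))) (cong suc (+-suc n (2 * l)))
  distrib : ∀ K x y F → K * (x + y) * F ≡ K * (x * F + y * F)
  distrib = solve-∀

-- Splitting on a removes the truncated subtraction a ∸ 1; for a = 0 necessarily l > 0.
closedForm-polynomial : ∀ k l a → suc k ≡ 2 * l + a →
  4 * (k * k + k + 4 * (l * l) + 4 * l) * (suc k * suc (suc k)) + (2 * k + 4) * ((2 * k + 3) * (2 * k + 2))
    ≡ suc (suc k) * ((2 * k + 2) * ((k + 2 * l + 3) * (k + 2 * l + 2) + a * (a ∸ 1)))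
closedForm-polynomial k l (suc a) 1+k≡2l+1+a with refl ← suc-injective (trans 1+k≡2l+1+a (+-suc (2 * l) a)) = identity l a
  where
  identity : ∀ l a → let k = 2 * l + a in
    4 * (k * k + k + 4 * (l * l) + 4 * l) * (suc k * suc (suc k)) + (2 * k + 4) * ((2 * k + 3) * (2 * k + 2))
      ≡ suc (suc k) * ((2 * k + 2) * ((k + 2 * l + 3) * (k + 2 * l + 2) + suc a * a))
  identity = solve-∀
closedForm-polynomial k (suc l) zero 1+k≡2+2l with refl ← suc-injective (trans 1+k≡2+2l (trans (+-identityʳ (2 * suc l)) (*-suc 2 l))) = identity l
  where
  identity : ∀ l → let k = suc (2 * l) in
    4 * (k * k + k + 4 * (suc l * suc l) + 4 * suc l) * (suc k * suc (suc k)) + (2 * k + 4) * ((2 * k + 3) * (2 * k + 2))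
      ≡ suc (suc k) * ((2 * k + 2) * ((k + 2 * suc l + 3) * (k + 2 * suc l + 2) + 0))
  identity = solve-∀

-- (2k+4)! is added to both sides so that no subtraction is needed.
closedForm : ∀ k l a → suc k ≡ 2 * l + a →
  weightedSum (suc k) (2 * l) * ((k + 2 * l + 3) ! * a !) ≡ 4 * (k * k + k + 4 * (l * l) + 4 * l) * (2 * k + 1) ! * (suc k * suc (suc k))
closedForm k l a 1+k≡2l+a = +-cancelʳ-≡ ((2 * K) !) _ _ (begin
  W * ((k + 2 * l + 3) ! * a !) + (2 * K) !                ≡⟨ cong (λ i → W * (i ! * a !) + (2 * K) !) (index k l) ⟩
  W * ((2 + (suc k + 2 * l)) ! * a !) + (2 * K) !          ≡⟨ weightedSum-factorials k l a 1+k≡2l+a ⟩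
  K * ((2 * suc k) ! * (P′ + b))                           ≡⟨ cong (λ i → K * (i ! * (P′ + b))) (2*[1+k] k) ⟩
  K * ((1 + (2 * k + 1)) ! * (P′ + b))                     ≡⟨ regroup k l b G ⟩
  G * (K * ((2 * k + 2) * (P + b)))                        ≡⟨ cong (G *_) (closedForm-polynomial k l a 1+k≡2l+a) ⟨
  G * (R′ * N + (2 * k + 4) * ((2 * k + 3) * (2 * k + 2))) ≡⟨ regroup′ k l G ⟩
  R′ * G * N + (3 + (2 * k + 1)) !                         ≡⟨ cong (λ i → R′ * G * N + i !) (2*[2+k] k) ⟨
  R′ * G * N + (2 * K) !                                   ∎)
  where
  K = suc (suc k)
  N = suc k * suc (suc k)
  W = weightedSum (suc k) (2 * l)
  G = (2 * k + 1) !
  b = a * (a ∸ 1)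
  R′ = 4 * (k * k + k + 4 * (l * l) + 4 * l)
  P = (k + 2 * l + 3) * (k + 2 * l + 2)
  P′ = (2 + (suc k + 2 * l)) * (1 + (suc k + 2 * l))
  index : ∀ k l → k + 2 * l + 3 ≡ 2 + (suc k + 2 * l)
  index = solve-∀
  2*[1+k] : ∀ k → 2 * suc k ≡ 1 + (2 * k + 1)
  2*[1+k] = solve-∀
  2*[2+k] : ∀ k → 2 * suc (suc k) ≡ 3 + (2 * k + 1)
  2*[2+k] = solve-∀
  regroup : ∀ k l b G → suc (suc k) * ((1 + (2 * k + 1)) * G * ((2 + (suc k + 2 * l)) * (1 + (suc k + 2 * l)) + b))
                        ≡ G * (suc (suc k) * ((2 * k + 2) * ((k + 2 * l + 3) * (k + 2 * l + 2) + b)))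
  regroup = solve-∀
  regroup′ : ∀ k l G → G * (4 * (k * k + k + 4 * (l * l) + 4 * l) * (suc k * suc (suc k)) + (2 * k + 4) * ((2 * k + 3) * (2 * k + 2)))
                       ≡ 4 * (k * k + k + 4 * (l * l) + 4 * l) * G * (suc k * suc (suc k)) + (3 + (2 * k + 1)) * ((2 + (2 * k + 1)) * ((1 + (2 * k + 1)) * G))
  regroup′ = solve-∀

infixl 7 _/ᴺ_

_/ᴺ_ : ℕ → (d : ℕ) .{{_ : NonZero d}} → ℚᵘ.ℚᵘ
a /ᴺ d = ℤ.+ a /ᵘ d

toℚᵘ-/ : ∀ a d .{{_ : NonZero d}} → toℚᵘ (ℤ.+ a /ℚ d) ≃ a /ᴺ d
toℚᵘ-/ a (suc d) = toℚᵘ-fromℚᵘ (mkℚᵘ (ℤ.+ a) d)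

/ᴺ-cross : ∀ a d b e .{{_ : NonZero d}} .{{_ : NonZero e}} → a * e ≡ b * d → a /ᴺ d ≃ b /ᴺ e
/ᴺ-cross a (suc d) b (suc e) a*e≡b*d = *≡* (begin
  ℤ.+ a ℤ.* ℤ.+ suc e ≡⟨ pos-* a (suc e) ⟨
  ℤ.+ (a * suc e)     ≡⟨ cong ℤ.+_ a*e≡b*d ⟩
  ℤ.+ (b * suc d)     ≡⟨ pos-* b (suc d) ⟩
  ℤ.+ b ℤ.* ℤ.+ suc d ∎)

/ᴺ-+ : ∀ a b d .{{_ : NonZero d}} → a /ᴺ d ℚᵘ.+ b /ᴺ d ≃ (a + b) /ᴺ d
/ᴺ-+ a b (suc d) = *≡* (begin
  (ℤ.+ a ℤ.* D ℤ.+ ℤ.+ b ℤ.* D) ℤ.* D ≡⟨ regroup (ℤ.+ a) (ℤ.+ b) D ⟩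
  (ℤ.+ a ℤ.+ ℤ.+ b) ℤ.* (D ℤ.* D)     ≡⟨ cong₂ ℤ._*_ (pos-+ a b) (pos-* (suc d) (suc d)) ⟨
  ℤ.+ (a + b) ℤ.* ℤ.+ (suc d * suc d) ∎)
  where
  D = ℤ.+ suc d
  regroup : ∀ x y z → (x ℤ.* z ℤ.+ y ℤ.* z) ℤ.* z ≡ (x ℤ.+ y) ℤ.* (z ℤ.* z)
  regroup = ℤ-Solver.solve-∀

sumℚ-applyUpTo : ∀ (f : ℕ → ℚ) (g : ℕ → ℕ) d .{{_ : NonZero d}} n → (∀ i → i < n → toℚᵘ (f i) ≃ g i /ᴺ d) →
                 toℚᵘ (sumℚ (applyUpTo f n)) ≃ ∑ n g /ᴺ d
sumℚ-applyUpTo f g d zero    f≃g = /ᴺ-cross 0 1 0 d refl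
sumℚ-applyUpTo f g d (suc n) f≃g =
  ≃-trans (toℚᵘ-homo-+ (f 0) _)
    (≃-trans (+ᵘ-cong (f≃g 0 z<s) (sumℚ-applyUpTo (λ i → f (suc i)) (λ i → g (suc i)) d n (λ i i<n → f≃g (suc i) (s<s i<n))))
      (/ᴺ-+ (g 0) _ d))

map-applyUpTo : ∀ {A B : Set} (f : A → B) (g : ℕ → A) n → map f (applyUpTo g n) ≡ applyUpTo (λ i → f (g i)) n
map-applyUpTo f g zero    = refl
map-applyUpTo f g (suc n) = cong (f (g 0) ∷_) (map-applyUpTo f (λ i → g (suc i)) n)

summand-numerator : ∀ k p q r → p ≤ k → q + r ≡ 2 + p →
  (k C p) * (suc p) ! * 2 ^ (k + 1 ∸ suc p) * (suc k * suc (suc k)) ≡ suc p * term (suc (suc k)) (suc (suc p)) q * (q ! * r !)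
summand-numerator k p q r p≤k q+r≡2+p = begin
  (k C p) * (suc p) ! * 2 ^ (k + 1 ∸ suc p) * N
    ≡⟨ cong (λ e → (k C p) * (suc p) ! * 2 ^ e * N) (cong (_∸ suc p) (+-comm k 1)) ⟩
  (k C p) * (suc p) ! * 2 ^ (k ∸ p) * N
    ≡⟨ regroup (k C p) ((suc p) !) (2 ^ (k ∸ p)) N ⟩
  2 ^ (k ∸ p) * (N * (k C p) * (suc p) !)
    ≡⟨ cong (λ x → 2 ^ (k ∸ p) * (x * (suc p) !)) (absorption² k p) ⟨
  2 ^ (k ∸ p) * (suc p * suc (suc p) * Y * (suc p) !)
    ≡⟨ regroup′ (2 ^ (k ∸ p)) p Y ((suc p) !) ⟩
  suc p * (2 ^ (k ∸ p) * (Y * (suc (suc p)) !))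
    ≡⟨ cong (λ x → suc p * (2 ^ (k ∸ p) * (Y * x))) (nCk*[k!*r!]≡n! q r q+r≡2+p) ⟨
  suc p * (2 ^ (k ∸ p) * (Y * ((suc (suc p) C q) * (q ! * r !))))
    ≡⟨ regroup″ (suc p) (2 ^ (k ∸ p)) Y (suc (suc p) C q) (q ! * r !) ⟩
  suc p * term (suc (suc k)) (suc (suc p)) q * (q ! * r !) ∎
  where
  N = suc k * suc (suc k)
  Y = suc (suc k) C suc (suc p)
  regroup : ∀ c f e n → c * f * e * n ≡ e * (n * c * f)
  regroup = solve-∀
  regroup′ : ∀ e p y f → e * (suc p * suc (suc p) * y * f) ≡ suc p * (e * (y * (suc (suc p) * f)))
  regroup′ = solve-∀
  regroup″ : ∀ p e y c g → p * (e * (y * (c * g))) ≡ p * (e * (y * c)) * g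
  regroup″ = solve-∀

-- Literally the guard in `summand`, so that `summand k l ν` unfolds to an `if` on it.
isSummandIndex : ℕ → ℕ → Bool
isSummandIndex l ν = (ν % 2 ≡ᵇ 0) ∧ ((2 * l) ≤ᵇ ν) ∧ not (ν ≡ᵇ 0)

isSummandIndex-parts : ∀ l ν → T (isSummandIndex l ν) → T (ν % 2 ≡ᵇ 0) × T ((2 * l) ≤ᵇ ν) × T (not (ν ≡ᵇ 0))
isSummandIndex-parts l ν isIndex with even , rest ← Equivalence.to T-∧ isIndex = even , Equivalence.to T-∧ rest

-- (k+1)(k+2) times the ν-th summand (see summand-numerator).
scaledSummand : ℕ → ℕ → ℕ → ℕ
scaledSummand k l ν = if isSummandIndex l ν then ν * term (suc (suc k)) (suc ν) (ν / 2 ∸ l) else 0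

if-then-0 : ∀ b {x : ℕ} → (T b → x ≡ 0) → (if b then x else 0) ≡ 0
if-then-0 true  x≡0 = x≡0 _
if-then-0 false _   = refl

toℚᵘ-if : ∀ b {q : ℚ} {z} d .{{_ : NonZero d}} → (T b → toℚᵘ q ≃ z /ᴺ d) → toℚᵘ (if b then q else 0ℚ) ≃ (if b then z else 0) /ᴺ d
toℚᵘ-if true  d q≃z = q≃z _
toℚᵘ-if false d _   = /ᴺ-cross 0 1 0 d refl

toℚᵘ-summand : ∀ k l ν → ν < k + 2 → toℚᵘ (summand k l ν) ≃ scaledSummand k l ν /ᴺ (suc k * suc (suc k))
toℚᵘ-summand k l zero    _     = toℚᵘ-if (isSummandIndex l 0) (suc k * suc (suc k))
  (λ isIndex → ⊥-elim (proj₂ (proj₂ (isSummandIndex-parts l 0 isIndex))))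
toℚᵘ-summand k l (suc p) ν<k+2 = toℚᵘ-if (isSummandIndex l (suc p)) (suc k * suc (suc k)) λ isIndex →
  ≃-trans (toℚᵘ-/ A (q ! * r !) {{q !* r !≢0}})
          (/ᴺ-cross A (q ! * r !) _ (suc k * suc (suc k)) {{q !* r !≢0}} (summand-numerator k p q r p≤k (q+r≡2+p isIndex)))
  where
  A = (k C p) * (suc p) ! * 2 ^ (k + 1 ∸ suc p)
  m = suc p / 2
  q = m ∸ l
  r = m + l + 1
  p≤k : p ≤ k
  p≤k = ≤-pred (≤-pred (subst (suc p <_) (+-comm k 2) ν<k+2))
  q+r≡2+p : T (isSummandIndex l (suc p)) → q + r ≡ 2 + p
  q+r≡2+p isIndex with even , 2l≤ν , _ ← isSummandIndex-parts l (suc p) isIndex = begin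
    (m ∸ l) + (m + l + 1)   ≡⟨ regroup (m ∸ l) l m ⟩
    suc (m ∸ l + l + m)     ≡⟨ cong (λ x → suc (x + m)) (m∸n+n≡m l≤m) ⟩
    suc (m + m)             ≡⟨ cong suc (m+m≡m*2 m) ⟩
    suc (m * 2)             ≡⟨ cong suc 1+p≡m*2 ⟨
    2 + p                   ∎
    where
    1+p≡m*2 : suc p ≡ m * 2
    1+p≡m*2 = trans (m≡m%n+[m/n]*n (suc p) 2) (cong (_+ m * 2) (≡ᵇ⇒≡ (suc p % 2) 0 even))
    l≤m : l ≤ m
    l≤m = *-cancelʳ-≤ l m 2 (subst₂ _≤_ (*-comm 2 l) 1+p≡m*2 (≤ᵇ⇒≤ (2 * l) (suc p) 2l≤ν))
    regroup : ∀ d l m → d + (m + l + 1) ≡ suc (d + l + m)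
    regroup = solve-∀
    m+m≡m*2 : ∀ m → m + m ≡ m * 2
    m+m≡m*2 = solve-∀

scaledSummand-odd : ∀ k l ν → ν % 2 ≡ 1 → scaledSummand k l ν ≡ 0
scaledSummand-odd k l ν odd = if-then-0 (isSummandIndex l ν) λ isIndex →
  ⊥-elim (subst (λ x → T (x ≡ᵇ 0)) odd (proj₁ (isSummandIndex-parts l ν isIndex)))

scaledSummand-below : ∀ k l ν → ν < 2 * l → scaledSummand k l ν ≡ 0
scaledSummand-below k l ν ν<2l = if-then-0 (isSummandIndex l ν) λ isIndex →
  ⊥-elim (<⇒≱ ν<2l (≤ᵇ⇒≤ (2 * l) ν (proj₁ (proj₂ (isSummandIndex-parts l ν isIndex)))))

scaledSummand-beyond : ∀ k l ν → k + 2 ≤ ν → scaledSummand k l ν ≡ 0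
scaledSummand-beyond k l ν k+2≤ν = if-then-0 (isSummandIndex l ν) λ _ →
  trans (cong (ν *_) (term-vanishes (ν / 2 ∸ l) (s≤s (subst (_≤ ν) (+-comm k 2) k+2≤ν)))) (*-zeroʳ ν)

scaledSummand-even : ∀ k l ν → ν % 2 ≡ 0 → 2 * l ≤ ν → scaledSummand k l ν ≡ ν * term (suc (suc k)) (suc ν) (ν / 2 ∸ l)
scaledSummand-even k l zero    _    _     with isSummandIndex l 0
... | true  = refl
... | false = refl
scaledSummand-even k l (suc p) even 2l≤ν rewrite even | Equivalence.to T-≡ (≤⇒≤ᵇ 2l≤ν) = refl

∑-scaledSummand : ∀ k l → ∑ (k + 2) (scaledSummand k l) ≡ weightedSum (suc k) (2 * l)
∑-scaledSummand k l = begin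
  ∑ (k + 2) Z
    ≡⟨ ∑-vanishing-tail Z (scaledSummand-beyond k l) k+2≤2l+2B ⟨
  ∑ (2 * l + 2 * B) Z
    ≡⟨ ∑-even-from (2 * l) B Z (scaledSummand-below k l) (λ u → scaledSummand-odd k l (2 * l + suc (2 * u)) (odd u)) ⟩
  ∑ B (λ u → Z (2 * l + 2 * u))
    ≡⟨ ∑-cong B (λ u _ → even-term u) ⟩
  weightedSum (suc k) (2 * l) ∎
  where
  Z = scaledSummand k l
  B = 3 + k
  k+2≤2l+2B : k + 2 ≤ 2 * l + 2 * B
  k+2≤2l+2B = ≤-trans (≤-trans (≤-reflexive (+-comm k 2)) (≤-trans (n≤1+n (2 + k)) (m≤n*m B 2))) (m≤n+m (2 * B) (2 * l))
  as-multiple : ∀ l u → 2 * l + 2 * u ≡ 0 + (l + u) * 2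
  as-multiple = solve-∀
  as-odd : ∀ l u → 2 * l + suc (2 * u) ≡ 1 + (l + u) * 2
  as-odd = solve-∀
  odd : ∀ u → (2 * l + suc (2 * u)) % 2 ≡ 1
  odd u = trans (cong (_% 2) (as-odd l u)) ([m+kn]%n≡m%n 1 (l + u) 2)
  even-term : ∀ u → Z (2 * l + 2 * u) ≡ (2 * l + 2 * u) * term (suc (suc k)) (suc (2 * l + 2 * u)) u
  even-term u = trans (scaledSummand-even k l ν even (m≤m+n (2 * l) (2 * u))) (cong (λ t → ν * term (suc (suc k)) (suc ν) t) half)
    where
    ν = 2 * l + 2 * u
    even : ν % 2 ≡ 0
    even = trans (cong (_% 2) (as-multiple l u)) ([m+kn]%n≡m%n 0 (l + u) 2)
    half : ν / 2 ∸ l ≡ u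
    half = trans (cong (λ x → x / 2 ∸ l) (as-multiple l u)) (trans (cong (_∸ l) (m*n/n≡m (l + u) 2)) (m+n∸m≡n l u))

toℚᵘ-lhs : ∀ k l → toℚᵘ (lhs k l) ≃ weightedSum (suc k) (2 * l) /ᴺ (suc k * suc (suc k))
toℚᵘ-lhs k l =
  ≃-trans (≃-reflexive (cong (λ xs → toℚᵘ (sumℚ xs)) (map-applyUpTo (summand k l) (λ i → i) (k + 2))))
    (≃-trans (sumℚ-applyUpTo (summand k l) (scaledSummand k l) (suc k * suc (suc k)) (k + 2) (toℚᵘ-summand k l))
      (≃-reflexive (cong (λ x → x /ᴺ (suc k * suc (suc k))) (∑-scaledSummand k l))))

mainTheorem4 : (k l : ℕ) → 2 * l ≤ k + 1 → lhs k l ≡ rhs k l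
mainTheorem4 k l 2l≤k+1 = toℚᵘ-injective (≃-trans (toℚᵘ-lhs k l) (≃-trans cross (≃-sym (toℚᵘ-/ R F {{F≢0}}))))
  where
  a = k + 1 ∸ 2 * l
  R = 4 * (k * k + k + 4 * (l * l) + 4 * l) * (2 * k + 1) !
  F = (k + 2 * l + 3) ! * a !
  F≢0 : NonZero F
  F≢0 = (k + 2 * l + 3) !* a !≢0
  1+k≡2l+a : suc k ≡ 2 * l + a
  1+k≡2l+a = trans (+-comm 1 k) (sym (m+[n∸m]≡n 2l≤k+1))
  cross : weightedSum (suc k) (2 * l) /ᴺ (suc k * suc (suc k)) ≃ (R /ᴺ F) {{F≢0}}
  cross = /ᴺ-cross _ (suc k * suc (suc k)) R F {{_}} {{F≢0}} (closedForm k l a 1+k≡2l+a)
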